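{- The sequence $\{\mathit{pa}(n)\}_{n\ge 1}$ is strictly increasing, where $\mathit{pa}(n)$ is the number of unlimited parity alternating partitions of $n$.
   Context: A partition of a positive integer $n$ is a weakly decreasing sequence of positive integers with sum $n$. An unlimited parity alternating partition is a partition whose different parts alternate in parity: if the distinct part sizes are $d_1>d_2>\cdots>d_r$, then $d_i$ and $d_{i+1}$ have different parities for every $i$ (parts may be repeated). $\mathit{pa}(n)$ is the number of such partitions of $n$. -}

module Defs where

open import Data.Nat using (ℕ; zero; suc; _+_; _≤_; _<_; _≥_; _≟_; _%_)
open import Data.List using (List; []; _∷_; length; deduplicate)
open import Data.Nat.ListAction using (sum)
open import Data.List.Relation.Unary.All using (All)
open import Data.List.Relation.Unary.Linked using (Linked)
open import Data.List.Relation.Unary.Unique.Propositional using (Unique)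
open import Data.List.Membership.Propositional using (_∈_)
open import Data.Product using (Σ; _×_)
open import Relation.Binary.PropositionalEquality using (_≡_; _≢_)
open import Function.Bundles using (_⇔_)

record IsPartition (n : ℕ) (λs : List ℕ) : Set where
  field
    positive   : All (λ x → 1 ≤ x) λs
    decreasing : Linked (λ a b → b ≤ a) λs
    sums       : sum λs ≡ n

-- The distinct part sizes d₁ > d₂ > ... > d_r (for a weakly decreasing list,
-- deduplication keeps them in decreasing order).
distinctParts : List ℕ → List ℕ
distinctParts = deduplicate _≟_

DiffParity : ℕ → ℕ → Set
DiffParity a b = a % 2 ≢ b % 2

IsPAPartition : ℕ → List ℕ → Set
IsPAPartition n λs = IsPartition n λs × Linked DiffParity (distinctParts λs)

-- "pa(n) = k": k is the number of unlimited parity alternating partitions of n,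
-- i.e. there is a duplicate-free list of length k whose members are exactly them.
PaCount : ℕ → ℕ → Set
PaCount n k = Σ (List (List ℕ)) λ L →
  Unique L × (∀ λs → (λs ∈ L) ⇔ IsPAPartition n λs) × length L ≡ k

module Submission where

-- pa(n) < pa(n+1) for n ≥ 1, by an explicit injection PA(n) → PA(n+1) that
-- misses a known element of PA(n+1).
--
-- 1. For a weakly decreasing list, "distinct parts alternate in parity" is
--    equivalent to the local condition that every two adjacent parts are
--    equal or of different parity ('Adjacent'); this turns IsPAPartition
--    into a predicate 'LocalPA' that is easy to preserve.
-- 2. The map 'grow' on a partition with smallest part s:
--    * if s is even or s = 1, append a part 1;
--    * otherwise (s odd, s ≥ 3), 'reshape': raise the largest part x by one
--      when that keeps the alternation (x repeated, or x the only part),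
--      and else, with y the second largest part, replace x by y and pad with
--      (x + 1 - y)/2 parts 2.
--    Images of the first kind end in 1, those of the second kind do not;
--    within each kind the input is recovered, so 'grow' is injective.
-- 3. (n + 1), or (h, h) with 2h = n + 1 when n is odd and n ≥ 3, is never
--    an image of 'grow'.
-- 4. A general counting lemma: an injection of a duplicate-free list into a
--    list that misses one of its members makes the first list strictly shorter.

open import Defs
open import Data.Nat using (ℕ; zero; suc; _+_; _∸_; _≤_; _<_; _≥_; _≟_; _%_; z≤n; s≤s; ⌊_/2⌋)
open import Data.Nat.Properties
  using (≤-refl; ≤-trans; ≤-<-trans; <-irrefl; ≤∧≢⇒<; <⇒≢; n≤1+n; n≢0⇒n>0; suc-injective; 0≢1+n; 1+n≢n;
         +-comm; +-suc; +-identityʳ; +-cancelʳ-≡; m+[n∸m]≡n; module ≤-Reasoning)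
open import Data.Nat.ListAction using (sum)
open import Data.Nat.ListAction.Properties using (sum-++)
open import Data.Nat.Solver using (module +-*-Solver)
open import Data.List using (List; []; _∷_; _++_; replicate; length; map)
open import Data.List.Properties using (filter-all; filter-reject; filter-idem; ∷-injective; ∷-injectiveˡ; ∷-injectiveʳ; ++-conicalʳ; ∷ʳ-injectiveˡ; length-++; length-map)
open import Data.List.Relation.Unary.All using (All; []; _∷_)
import Data.List.Relation.Unary.All as All
open import Data.List.Relation.Unary.All.Properties using (deduplicate⁺; ++⁺; map⁺)
open import Data.List.Relation.Unary.Any using (here; there)
open import Data.List.Relation.Unary.AllPairs using ([]; _∷_)
open import Data.List.Relation.Unary.Linked using (Linked; []; [-]; _∷_)
import Data.List.Relation.Unary.Linked as Linked
open import Data.List.Relation.Unary.Unique.Propositional using (Unique)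
open import Data.List.Membership.Propositional using (_∈_)
open import Data.List.Membership.Propositional.Properties using (∈-∃++; ∈-++⁻; ∈-++⁺ˡ; ∈-++⁺ʳ; ∈-map⁻)
open import Data.List.Relation.Binary.Subset.Propositional using (_⊆_)
open import Data.Product using (Σ; _×_; _,_)
open import Data.Sum using (_⊎_; inj₁; inj₂)
open import Data.Empty using (⊥-elim)
open import Relation.Nullary using (¬_; Dec; yes; no; ¬?; _⊎-dec_)
open import Relation.Binary.PropositionalEquality using (_≡_; _≢_; refl; sym; trans; cong; cong₂; subst; module ≡-Reasoning)
open import Function.Bundles using (_⇔_; mk⇔; Equivalence)

suc-%2 : ∀ n → suc n % 2 ≡ 1 ∸ n % 2
suc-%2 zero = refl
suc-%2 (suc zero) = refl
suc-%2 (suc (suc n)) = suc-%2 n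

suc-even : ∀ n → n % 2 ≢ 0 → suc n % 2 ≡ 0
suc-even zero odd = ⊥-elim (odd refl)
suc-even (suc zero) _ = refl
suc-even (suc (suc n)) odd = suc-even n odd

diffParity-suc : ∀ x → DiffParity (suc x) x
diffParity-suc zero = λ ()
diffParity-suc (suc x) e = diffParity-suc x (sym e)

diffParity-pred : ∀ x y → DiffParity (suc x) (suc y) → DiffParity x y
diffParity-pred x y d e = d (trans (suc-%2 x) (trans (cong (1 ∸_) e) (sym (suc-%2 y))))

even-gap : ∀ x y → y < x → DiffParity x y → (x ∸ suc y) % 2 ≡ 0
even-gap (suc zero) zero _ _ = refl
even-gap (suc (suc zero)) zero _ d = ⊥-elim (d refl)
even-gap (suc (suc (suc x))) zero _ d = even-gap (suc x) zero (s≤s z≤n) d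
even-gap (suc x) (suc y) (s≤s y<x) d = even-gap x y y<x (diffParity-pred x y d)

half-even : ∀ m → m % 2 ≡ 0 → ⌊ m /2⌋ + ⌊ m /2⌋ ≡ m
half-even zero _ = refl
half-even (suc (suc m)) e = cong suc (trans (+-suc ⌊ m /2⌋ ⌊ m /2⌋) (cong suc (half-even m e)))

EqOrDiffParity : ℕ → ℕ → Set
EqOrDiffParity a b = a ≡ b ⊎ DiffParity a b

Decreasing : List ℕ → Set
Decreasing = Linked (λ a b → b ≤ a)

distinctParts-repeat : ∀ x l → distinctParts (x ∷ x ∷ l) ≡ distinctParts (x ∷ l)
distinctParts-repeat x l = cong (x ∷_)
  (trans (filter-reject (λ y → ¬? (x ≟ y)) (λ x≢x → x≢x refl))
         (filter-idem (λ y → ¬? (x ≟ y)) (distinctParts l)))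

distinctParts-fresh : ∀ x l → All (_< x) l → distinctParts (x ∷ l) ≡ x ∷ distinctParts l
distinctParts-fresh x l below = cong (x ∷_) (filter-all (λ y → ¬? (x ≟ y))
  (All.map (λ y<x x≡y → <-irrefl (sym x≡y) y<x) (deduplicate⁺ _≟_ below)))

head-bounds : ∀ {x xs} → Decreasing (x ∷ xs) → All (_≤ x) (x ∷ xs)
head-bounds [-] = ≤-refl ∷ []
head-bounds (y≤x ∷ rest) = ≤-refl ∷ All.map (λ z≤y → ≤-trans z≤y y≤x) (head-bounds rest)

alternation⇔local : ∀ xs → Decreasing xs →
  Linked DiffParity (distinctParts xs) ⇔ Linked EqOrDiffParity xs
alternation⇔local [] _ = mk⇔ (λ _ → []) (λ _ → [])
alternation⇔local (x ∷ []) _ = mk⇔ (λ _ → [-]) (λ _ → [-])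
alternation⇔local (x ∷ y ∷ l) (y≤x ∷ dec) with x ≟ y | alternation⇔local (y ∷ l) dec
... | yes refl | ih = mk⇔
  (λ p → inj₁ refl ∷ Equivalence.to ih (subst (Linked DiffParity) (distinctParts-repeat x l) p))
  (λ { (_ ∷ q) → subst (Linked DiffParity) (sym (distinctParts-repeat x l)) (Equivalence.from ih q) })
... | no x≢y | ih = mk⇔ to from
  where
  fresh : distinctParts (x ∷ y ∷ l) ≡ x ∷ distinctParts (y ∷ l)
  fresh = distinctParts-fresh x (y ∷ l)
    (All.map (λ z≤y → ≤-<-trans z≤y (≤∧≢⇒< y≤x (λ y≡x → x≢y (sym y≡x)))) (head-bounds dec))
  to : Linked DiffParity (distinctParts (x ∷ y ∷ l)) → Linked EqOrDiffParity (x ∷ y ∷ l)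
  to p with subst (Linked DiffParity) fresh p
  ... | d ∷ q = inj₂ d ∷ Equivalence.to ih q
  from : Linked EqOrDiffParity (x ∷ y ∷ l) → Linked DiffParity (distinctParts (x ∷ y ∷ l))
  from (inj₁ x≡y ∷ _) = ⊥-elim (x≢y x≡y)
  from (inj₂ d ∷ q) = subst (Linked DiffParity) (sym fresh) (d ∷ Equivalence.from ih q)

Adjacent : ℕ → ℕ → Set
Adjacent a b = b ≤ a × EqOrDiffParity a b

LocalPA : ℕ → List ℕ → Set
LocalPA n xs = All (1 ≤_) xs × Linked Adjacent xs × sum xs ≡ n

pa⇔local : ∀ n xs → IsPAPartition n xs ⇔ LocalPA n xs
pa⇔local n xs = mk⇔ to from
  where
  to : IsPAPartition n xs → LocalPA n xs
  to (p , alt) = IsPartition.positive p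
    , Linked.zip (IsPartition.decreasing p , Equivalence.to (alternation⇔local xs (IsPartition.decreasing p)) alt)
    , IsPartition.sums p
  from : LocalPA n xs → IsPAPartition n xs
  from (pos , adj , s) with Linked.unzip adj
  ... | dec , local = record { positive = pos ; decreasing = dec ; sums = s }
                    , Equivalence.from (alternation⇔local xs dec) local

-- The last part of a list, i.e. the smallest part of a partition (0 for []).
lastPart : List ℕ → ℕ
lastPart [] = 0
lastPart (x ∷ []) = x
lastPart (x ∷ y ∷ r) = lastPart (y ∷ r)

lastPart-++ : ∀ xs b bs → lastPart (xs ++ b ∷ bs) ≡ lastPart (b ∷ bs)
lastPart-++ [] b bs = refl
lastPart-++ (x ∷ []) b bs = refl
lastPart-++ (x ∷ y ∷ r) b bs = lastPart-++ (y ∷ r) b bs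

lastPart-replicate : ∀ t c → lastPart (c ∷ replicate t c) ≡ c
lastPart-replicate zero c = refl
lastPart-replicate (suc t) c = lastPart-replicate t c

lastPart-positive : ∀ x xs → All (1 ≤_) (x ∷ xs) → 1 ≤ lastPart (x ∷ xs)
lastPart-positive x [] (p ∷ _) = p
lastPart-positive x (y ∷ xs) (_ ∷ ps) = lastPart-positive y xs ps

linked-++ : ∀ {Q : ℕ → ℕ → Set} x xs a as → Linked Q (x ∷ xs) →
  Q (lastPart (x ∷ xs)) a → Linked Q (a ∷ as) → Linked Q ((x ∷ xs) ++ a ∷ as)
linked-++ x [] a as [-] q rest = q ∷ rest
linked-++ x (y ∷ xs) a as (p ∷ ps) q rest = p ∷ linked-++ y xs a as ps q rest

twos-local : ∀ k → LocalPA (k + k) (replicate k 2)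
twos-local k = positive k , linked k , sum-twos k
  where
  positive : ∀ k → All (1 ≤_) (replicate k 2)
  positive zero = []
  positive (suc k) = s≤s z≤n ∷ positive k
  linked : ∀ k → Linked Adjacent (replicate k 2)
  linked zero = []
  linked (suc zero) = [-]
  linked (suc (suc k)) = (≤-refl , inj₁ refl) ∷ linked (suc k)
  sum-twos : ∀ k → sum (replicate k 2) ≡ k + k
  sum-twos zero = refl
  sum-twos (suc k) = cong suc (trans (cong suc (sum-twos k)) (sym (+-suc k k)))

strict-step : ∀ {x y} → x ≢ y → Adjacent x y → y < x × DiffParity x y
strict-step x≢y (y≤x , inj₁ x≡y) = ⊥-elim (x≢y x≡y)
strict-step x≢y (y≤x , inj₂ d) = ≤∧≢⇒< y≤x (λ y≡x → x≢y (sym y≡x)) , d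

OneAppendable : List ℕ → Set
OneAppendable xs = lastPart xs % 2 ≡ 0 ⊎ lastPart xs ≡ 1

oneAppendable? : ∀ xs → Dec (OneAppendable xs)
oneAppendable? xs = lastPart xs % 2 ≟ 0 ⊎-dec lastPart xs ≟ 1

-- For parts y < x of different parity, x + 1 = y + 2 (1 + halfGap x y).
halfGap : ℕ → ℕ → ℕ
halfGap x y = ⌊ (x ∸ suc y) /2⌋

gap-split : ∀ x y → y < x → DiffParity x y → suc y + (halfGap x y + halfGap x y) ≡ x
gap-split x y y<x d = trans (cong (suc y +_) (half-even (x ∸ suc y) (even-gap x y y<x d))) (m+[n∸m]≡n y<x)

reshape : List ℕ → List ℕ
reshape [] = []
reshape (x ∷ []) = suc x ∷ []
reshape (x ∷ y ∷ r) with x ≟ y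
... | yes _ = suc x ∷ y ∷ r
... | no _ = y ∷ y ∷ r ++ replicate (suc (halfGap x y)) 2

grow : List ℕ → List ℕ
grow xs with oneAppendable? xs
... | yes _ = xs ++ 1 ∷ []
... | no _ = reshape xs

adjacent-one : ∀ l → 1 ≤ l → l % 2 ≡ 0 ⊎ l ≡ 1 → Adjacent l 1
adjacent-one l pos (inj₁ even) = pos , inj₂ (λ e → 0≢1+n (trans (sym even) e))
adjacent-one .1 _ (inj₂ refl) = ≤-refl , inj₁ refl

appendOne-local : ∀ n xs → LocalPA n xs → OneAppendable xs → LocalPA (suc n) (xs ++ 1 ∷ [])
appendOne-local n [] (_ , _ , s) _ = s≤s z≤n ∷ [] , [-] , cong suc s
appendOne-local n (x ∷ xs) (pos , adj , s) app =
  ++⁺ pos (s≤s z≤n ∷ []) , linked-++ x xs 1 [] adj junction [-] , total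
  where
  junction : Adjacent (lastPart (x ∷ xs)) 1
  junction = adjacent-one (lastPart (x ∷ xs)) (lastPart-positive x xs pos) app
  total : sum ((x ∷ xs) ++ 1 ∷ []) ≡ suc n
  total = trans (sum-++ (x ∷ xs) (1 ∷ [])) (trans (+-comm (sum (x ∷ xs)) 1) (cong suc s))

-- Otherwise reshaping maps PA(n) to PA(n + 1): a repeated or sole largest part
-- x becomes x + 1, of parity opposite to its neighbour x; in the remaining case
-- the parts 2 follow an odd smallest part ≥ 3 and add up to x + 1 - y.
reshape-local : ∀ n xs → LocalPA n xs → ¬ OneAppendable xs → LocalPA (suc n) (reshape xs)
reshape-local n [] _ ¬app = ⊥-elim (¬app (inj₁ refl))
reshape-local n (x ∷ []) (_ , _ , s) _ = s≤s z≤n ∷ [] , [-] , cong suc s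
reshape-local n (x ∷ y ∷ r) _ _ with x ≟ y
reshape-local n (x ∷ .x ∷ r) (_ ∷ pos , _ ∷ adj , s) _ | yes refl =
  s≤s z≤n ∷ pos , (n≤1+n x , inj₂ (diffParity-suc x)) ∷ adj , cong suc s
reshape-local n (x ∷ y ∷ r) (_ ∷ py ∷ pr , a ∷ adj , s) ¬app | no x≢y
  with strict-step x≢y a | twos-local (suc (halfGap x y))
... | y<x , d | twos-pos , twos-adj , twos-sum =
  py ∷ py ∷ ++⁺ pr twos-pos , (≤-refl , inj₁ refl) ∷ linked-++ y r 2 _ adj junction twos-adj , total
  where
  open +-*-Solver
  open ≡-Reasoning
  k : ℕ
  k = halfGap x y
  junction : Adjacent (lastPart (y ∷ r)) 2
  junction = ≤∧≢⇒< (lastPart-positive y r (py ∷ pr)) (λ one → ¬app (inj₂ (sym one)))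
           , inj₂ (λ even → ¬app (inj₁ even))
  total : sum (y ∷ y ∷ r ++ replicate (suc k) 2) ≡ suc n
  total = begin
      y + (y + sum (r ++ replicate (suc k) 2))
    ≡⟨ cong (λ t → y + (y + t)) (trans (sum-++ r _) (cong (sum r +_) twos-sum)) ⟩
      y + (y + (sum r + suc (k + suc k)))
    ≡⟨ solve 3 (λ y s k → y :+ (y :+ (s :+ (con 1 :+ (k :+ (con 1 :+ k)))))
                      := con 1 :+ ((con 1 :+ y :+ (k :+ k)) :+ (y :+ s))) refl y (sum r) k ⟩
      suc ((suc y + (k + k)) + (y + sum r))
    ≡⟨ cong (λ t → suc (t + (y + sum r))) (gap-split x y y<x d) ⟩
      suc (x + (y + sum r))
    ≡⟨ cong suc s ⟩
      suc n ∎

grow-local : ∀ n xs → LocalPA n xs → LocalPA (suc n) (grow xs)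
grow-local n xs lp with oneAppendable? xs
... | yes app = appendOne-local n xs lp app
... | no ¬app = reshape-local n xs lp ¬app

block-prefix : ∀ c t b bs zs → replicate t c ≡ (b ∷ bs) ++ zs → lastPart (b ∷ bs) ≡ c
block-prefix c (suc t) b [] zs eq = sym (∷-injectiveˡ eq)
block-prefix c (suc t) b (b' ∷ bs) zs eq = block-prefix c t b' bs zs (∷-injectiveʳ eq)

strip-block : ∀ c a as b bs t t' → lastPart (a ∷ as) ≢ c → lastPart (b ∷ bs) ≢ c →
  (a ∷ as) ++ replicate t c ≡ (b ∷ bs) ++ replicate t' c → a ∷ as ≡ b ∷ bs
strip-block c a [] b [] t t' _ _ eq = cong (_∷ []) (∷-injectiveˡ eq)
strip-block c a [] b (b' ∷ bs) t t' _ b≢c eq = ⊥-elim (b≢c (block-prefix c t b' bs _ (∷-injectiveʳ eq)))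
strip-block c a (a' ∷ as) b [] t t' a≢c _ eq = ⊥-elim (a≢c (block-prefix c t' a' as _ (sym (∷-injectiveʳ eq))))
strip-block c a (a' ∷ as) b (b' ∷ bs) t t' a≢c b≢c eq =
  cong₂ _∷_ (∷-injectiveˡ eq) (strip-block c a' as b' bs t t' a≢c b≢c (∷-injectiveʳ eq))

reshape-lastPart : ∀ xs → ¬ OneAppendable xs → lastPart (reshape xs) ≢ 1
reshape-lastPart [] ¬app = ⊥-elim (¬app (inj₁ refl))
reshape-lastPart (zero ∷ []) ¬app = ⊥-elim (¬app (inj₁ refl))
reshape-lastPart (suc x ∷ []) ¬app = λ ()
reshape-lastPart (x ∷ y ∷ r) ¬app with x ≟ y
... | yes _ = λ one → ¬app (inj₂ one)
... | no _ = λ one → 0≢1+n (suc-injective (trans (sym one) (trans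
  (lastPart-++ (y ∷ r) 2 (replicate (halfGap x y) 2)) (lastPart-replicate (halfGap x y) 2))))

-- ... and, among partitions of the same n, reshape is injective: the first two
-- output parts tell which case applied, the trailing parts 2 can be stripped
-- off because the smallest input part is odd, and the largest input part is
-- then fixed by the sum.
reshape-injective : ∀ n xs ys → LocalPA n xs → LocalPA n ys →
  ¬ OneAppendable xs → ¬ OneAppendable ys → reshape xs ≡ reshape ys → xs ≡ ys
reshape-injective n [] _ _ _ ¬app _ _ = ⊥-elim (¬app (inj₁ refl))
reshape-injective n _ [] _ _ _ ¬app _ = ⊥-elim (¬app (inj₁ refl))
reshape-injective n (x ∷ []) (x' ∷ []) _ _ _ _ refl = refl
reshape-injective n (x ∷ []) (x' ∷ y' ∷ r') _ _ _ _ eq with x' ≟ y'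
reshape-injective n (x ∷ []) (x' ∷ y' ∷ r') _ _ _ _ () | yes _
reshape-injective n (x ∷ []) (x' ∷ y' ∷ r') _ _ _ _ () | no _
reshape-injective n (x ∷ y ∷ r) (x' ∷ []) _ _ _ _ eq with x ≟ y
reshape-injective n (x ∷ y ∷ r) (x' ∷ []) _ _ _ _ () | yes _
reshape-injective n (x ∷ y ∷ r) (x' ∷ []) _ _ _ _ () | no _
reshape-injective n (x ∷ y ∷ r) (x' ∷ y' ∷ r') _ _ _ _ eq with x ≟ y | x' ≟ y'
reshape-injective n (x ∷ .x ∷ r) (x' ∷ .x' ∷ r') _ _ _ _ refl | yes refl | yes refl = refl
... | yes refl | no _ = ⊥-elim (1+n≢n (trans (∷-injectiveˡ eq) (sym (∷-injectiveˡ (∷-injectiveʳ eq)))))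
... | no _ | yes refl = ⊥-elim (1+n≢n (trans (sym (∷-injectiveˡ eq)) (∷-injectiveˡ (∷-injectiveʳ eq))))
reshape-injective n (x ∷ y ∷ r) (x' ∷ y' ∷ r') (_ , _ , s) (_ , _ , s') ¬app ¬app' eq | no _ | no _
  with ∷-injective eq
... | refl , tail-eq with strip-block 2 y r y r' _ _
                           (λ two → ¬app (inj₁ (cong (_% 2) two))) (λ two → ¬app' (inj₁ (cong (_% 2) two)))
                           tail-eq
... | refl = cong (λ z → z ∷ y ∷ r) (+-cancelʳ-≡ (y + sum r) x x' (trans s (sym s')))

-- Hence grow is injective on PA(n): appended outputs end in 1, reshaped ones do not.
grow-injective : ∀ n xs ys → LocalPA n xs → LocalPA n ys → grow xs ≡ grow ys → xs ≡ ys
grow-injective n xs ys lx ly eq with oneAppendable? xs | oneAppendable? ys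
... | yes _ | yes _ = ∷ʳ-injectiveˡ xs ys eq
... | yes _ | no ¬app = ⊥-elim (reshape-lastPart ys ¬app (trans (cong lastPart (sym eq)) (lastPart-++ xs 1 [])))
... | no ¬app | yes _ = ⊥-elim (reshape-lastPart xs ¬app (trans (cong lastPart eq) (lastPart-++ ys 1 [])))
... | no ¬app | no ¬app' = reshape-injective n xs ys lx ly ¬app ¬app' eq

++-nonempty : ∀ {a} {A : Set a} (xs : List A) c cs → xs ++ c ∷ cs ≢ []
++-nonempty xs c cs e with ++-conicalʳ xs (c ∷ cs) e
... | ()

single-missed : ∀ n → n ≥ 1 → OneAppendable (n ∷ []) → ∀ xs → grow xs ≢ suc n ∷ []
single-missed n n≥1 app xs eq with oneAppendable? xs
single-missed n n≥1 app [] eq | yes _ = <⇒≢ n≥1 (suc-injective (∷-injectiveˡ eq))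
single-missed n n≥1 app (x ∷ xs) eq | yes _ = ++-nonempty xs 1 [] (∷-injectiveʳ eq)
single-missed n n≥1 app [] eq | no ¬app = ¬app (inj₁ refl)
single-missed n n≥1 app (x ∷ []) eq | no ¬app =
  ¬app (subst (λ m → OneAppendable (m ∷ [])) (sym (suc-injective (∷-injectiveˡ eq))) app)
single-missed n n≥1 app (x ∷ y ∷ r) eq | no ¬app with x ≟ y
single-missed n n≥1 app (x ∷ y ∷ r) () | no ¬app | yes _
single-missed n n≥1 app (x ∷ y ∷ r) () | no ¬app | no _

pair-missed : ∀ n h → ¬ OneAppendable (n ∷ []) → h + h ≡ suc n → ∀ xs → grow xs ≢ h ∷ h ∷ []
pair-missed n h ¬appₙ hh xs eq with oneAppendable? xs
pair-missed n h ¬appₙ hh [] () | yes _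
pair-missed n h ¬appₙ hh (x ∷ []) eq | yes _ with ∷-injectiveˡ (∷-injectiveʳ eq)
... | refl = ¬appₙ (inj₂ (suc-injective (sym hh)))
pair-missed n h ¬appₙ hh (x ∷ y ∷ cs) eq | yes _ = ++-nonempty cs 1 [] (∷-injectiveʳ (∷-injectiveʳ eq))
pair-missed n h ¬appₙ hh [] eq | no ¬app = ¬app (inj₁ refl)
pair-missed n h ¬appₙ hh (x ∷ []) () | no ¬app
pair-missed n h ¬appₙ hh (x ∷ y ∷ r) eq | no ¬app with x ≟ y
... | yes refl = 1+n≢n (trans (∷-injectiveˡ eq) (sym (∷-injectiveˡ (∷-injectiveʳ eq))))
... | no _ = ++-nonempty r 2 _ (∷-injectiveʳ (∷-injectiveʳ eq))

missed : ∀ n → n ≥ 1 → Σ (List ℕ) λ z → LocalPA (suc n) z × (∀ xs → grow xs ≢ z)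
missed n n≥1 with oneAppendable? (n ∷ [])
... | yes app = suc n ∷ [] , (s≤s z≤n ∷ [] , [-] , cong suc (+-identityʳ n)) , single-missed n n≥1 app
... | no ¬app = h ∷ h ∷ [] , (h≥1 ∷ h≥1 ∷ [] , (≤-refl , inj₁ refl) ∷ [-] , trans (cong (h +_) (+-identityʳ h)) hh)
              , pair-missed n h ¬app hh
  where
  h : ℕ
  h = ⌊ suc n /2⌋
  hh : h + h ≡ suc n
  hh = half-even (suc n) (suc-even n (λ even → ¬app (inj₁ even)))
  h≥1 : 1 ≤ h
  h≥1 = n≢0⇒n>0 (λ h≡0 → 0≢1+n (trans (sym (cong (λ k → k + k) h≡0)) hh))

unique-⊆-length : ∀ {a} {A : Set a} {xs ys : List A} → Unique xs → xs ⊆ ys → length xs ≤ length ys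
unique-⊆-length {xs = []} _ _ = z≤n
unique-⊆-length {xs = x ∷ xs} (x∉xs ∷ unique) sub with ∈-∃++ (sub (here refl))
... | us , vs , refl = begin
    suc (length xs)              ≤⟨ s≤s (unique-⊆-length unique rest⊆) ⟩
    suc (length (us ++ vs))      ≡⟨ cong suc (length-++ us) ⟩
    suc (length us + length vs)  ≡⟨ sym (+-suc (length us) (length vs)) ⟩
    length us + suc (length vs)  ≡⟨ sym (length-++ us) ⟩
    length (us ++ x ∷ vs)        ∎
  where
  open ≤-Reasoning
  -- The other elements of xs avoid x, hence survive its removal from ys.
  rest⊆ : xs ⊆ us ++ vs
  rest⊆ w∈xs with ∈-++⁻ us (sub (there w∈xs))
  ... | inj₁ w∈us = ∈-++⁺ˡ w∈us
  ... | inj₂ (here refl) = ⊥-elim (All.lookup x∉xs w∈xs refl)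
  ... | inj₂ (there w∈vs) = ∈-++⁺ʳ us w∈vs

map-unique : ∀ {a b} {A : Set a} {B : Set b} (h : A → B) {xs : List A} → Unique xs →
  (∀ {u v} → u ∈ xs → v ∈ xs → h u ≡ h v → u ≡ v) → Unique (map h xs)
map-unique h {[]} [] _ = []
map-unique h {x ∷ xs} (x∉xs ∷ unique) injective =
  map⁺ (All.tabulate (λ v∈xs e → All.lookup x∉xs v∈xs (injective (here refl) (there v∈xs) e)))
  ∷ map-unique h unique (λ u∈xs v∈xs → injective (there u∈xs) (there v∈xs))

shorter-by-injection : ∀ {a b} {A : Set a} {B : Set b} (h : A → B) (z : B) {xs : List A} {ys : List B} →
  Unique xs → (∀ {u v} → u ∈ xs → v ∈ xs → h u ≡ h v → u ≡ v) →
  (∀ {u} → u ∈ xs → h u ∈ ys) → (∀ {u} → u ∈ xs → h u ≢ z) → z ∈ ys →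
  length xs < length ys
shorter-by-injection h z {xs} {ys} unique injective into misses z∈ys =
  subst (λ m → suc m ≤ length ys) (length-map h xs) (unique-⊆-length image-unique image⊆)
  where
  image-unique : Unique (z ∷ map h xs)
  image-unique = map⁺ (All.tabulate (λ u∈xs e → misses u∈xs (sym e))) ∷ map-unique h unique injective
  image⊆ : z ∷ map h xs ⊆ ys
  image⊆ (here refl) = z∈ys
  image⊆ (there w∈image) with ∈-map⁻ h w∈image
  ... | u , u∈xs , refl = into u∈xs

theorem2p1 : ∀ n → n ≥ 1 → ∀ a b → PaCount n a → PaCount (suc n) b → a < b
theorem2p1 n n≥1 a b (L₁ , unique₁ , members₁ , refl) (L₂ , _ , members₂ , refl)
  with missed n n≥1
... | z , z-local , z-missed =
  shorter-by-injection grow z unique₁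
    (λ p q → grow-injective n _ _ (local p) (local q))
    (λ p → member₂ (grow-local n _ (local p)))
    (λ {xs} _ → z-missed xs)
    (member₂ z-local)
  where
  local : ∀ {xs} → xs ∈ L₁ → LocalPA n xs
  local {xs} m = Equivalence.to (pa⇔local n xs) (Equivalence.to (members₁ xs) m)
  member₂ : ∀ {xs} → LocalPA (suc n) xs → xs ∈ L₂
  member₂ {xs} lp = Equivalence.from (members₂ xs) (Equivalence.from (pa⇔local (suc n) xs) lp)
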